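{- Let $(\mathcal{Y}_x)_{x\in\mathbb{N}}$ be a sequence of finite subsets of $\mathbb{Z}$ that is additively periodic with period length $p\in\mathbb{N}^+$ and has difference bounds $M^-<0<M^+$, and let $G$ be any Nim sequence over $(\mathcal{Y}_x)$. Then $G$ is additively periodic, and its period length $\tilde p$ satisfies $$\tilde p\le\binom{M}{\min(|M^-|,M^+)}\,p.$$
   Context: $\mathbb{N}=\{0,1,2,\dots\}$, $\mathbb{N}^+=\{1,2,\dots\}$. For a finite $Y\subseteq\mathbb{Z}$, $\operatorname{mex}(Y)=\min(\mathbb{N}\setminus Y)$. A sequence $(\mathcal{Y}_x)_{x\in\mathbb{N}}$ of finite subsets of $\mathbb{Z}$ is additively periodic with period length $p$ if $\mathcal{Y}_{x+p}=\mathcal{Y}_x+p$ for all $x\in\mathbb{N}$, $p$ being the least positive integer with this property. Its difference bounds are $M^+=\max\{z-x: x\in\mathbb{N}, z\in\mathcal{Y}_x\}+1$ and $M^-=\min\{z-x: x\in\mathbb{N}, z\in\mathcal{Y}_x\}-1$, and $M=|M^-|+M^+$. A Nim sequence over $(\mathcal{Y}_x)$ with seed $[g_0,\dots,g_{L-1}]$ ($L\in\mathbb{N}$, $g_i\in\mathbb{N}$ pairwise distinct) is $G:\mathbb{N}\to\mathbb{N}$ with $G(x)=g_x$ for $x<L$ and $G(x)=\operatorname{mex}(\{G(x'):x'<x\}\cup\mathcal{Y}_x)$ for $x\ge L$. $G$ is additively periodic if there are $\tilde P\in\mathbb{N}$, $\tilde p\in\mathbb{N}^+$ with $G(x+\tilde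 p)=G(x)+\tilde p$ for all $x\ge\tilde P$; the least such $\tilde p$ is the period length. -}

module Defs where

open import Data.Nat as ℕ using (ℕ; suc; _<_; _≤_)
open import Data.Integer as ℤ using (ℤ; +_; ∣_∣)
open import Data.List using (List; map; length; lookup)
open import Data.List.Membership.Propositional using (_∈_; _∉_)
open import Data.List.Relation.Unary.Unique.Propositional using (Unique)
open import Data.Fin using (fromℕ<)
open import Data.Product using (Σ; ∃; _×_)
open import Data.Sum using (_⊎_)
open import Relation.Binary.PropositionalEquality using (_≡_)
open import Function.Bundles using (_⇔_)

SetSeq : Set
SetSeq = ℕ → List ℤ

ShiftInvariant : SetSeq → ℕ → Set
ShiftInvariant Y p = ∀ x z → z ∈ Y (x ℕ.+ p) ⇔ z ∈ map (ℤ._+ + p) (Y x)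

IsAddPeriodicSeqWithPeriod : SetSeq → ℕ → Set
IsAddPeriodicSeqWithPeriod Y p =
  0 < p × ShiftInvariant Y p × (∀ q → 0 < q → ShiftInvariant Y q → p ≤ q)

IsUpperDiffBound : SetSeq → ℤ → Set
IsUpperDiffBound Y Mp =
  (∀ x z → z ∈ Y x → (z ℤ.- + x) ℤ.+ ℤ.1ℤ ℤ.≤ Mp) ×
  (∃ λ x → Σ ℤ λ z → z ∈ Y x × (z ℤ.- + x) ℤ.+ ℤ.1ℤ ≡ Mp)

IsLowerDiffBound : SetSeq → ℤ → Set
IsLowerDiffBound Y Mm =
  (∀ x z → z ∈ Y x → Mm ℤ.≤ (z ℤ.- + x) ℤ.- ℤ.1ℤ) ×
  (∃ λ x → Σ ℤ λ z → z ∈ Y x × (z ℤ.- + x) ℤ.- ℤ.1ℤ ≡ Mm)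

IsMex : (ℕ → Set) → ℕ → Set
IsMex S m = (S m → Data.Empty.⊥) × (∀ k → k < m → S k)
  where import Data.Empty

IsNimSeq : SetSeq → List ℕ → (ℕ → ℕ) → Set
IsNimSeq Y s G =
  (∀ x (h : x < length s) → G x ≡ lookup s (fromℕ< h)) ×
  (∀ x → length s ≤ x →
     IsMex (λ k → (∃ λ x' → x' < x × G x' ≡ k) ⊎ (+ k) ∈ Y x) (G x))

HasAddPeriod : (ℕ → ℕ) → ℕ → Set
HasAddPeriod G q = ∃ λ P → ∀ x → P ≤ x → G (x ℕ.+ q) ≡ G x ℕ.+ q

IsAddPeriodLength : (ℕ → ℕ) → ℕ → Set
IsAddPeriodLength G q =
  0 < q × HasAddPeriod G q × (∀ q' → 0 < q' → HasAddPeriod G q' → q ≤ q')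

-- After finitely many steps a Nim sequence settles down: every value below x − |M⁻| has
-- been used before x, and every value used before x is below x + M⁺. From then on, which
-- values are used near x is recorded by a window of M = |M⁻| + M⁺ bits containing exactly
-- |M⁻| ones, and there are only C(M, |M⁻|) such windows. Among the windows at x, x + p, …,
-- x + C(M, |M⁻|) p two therefore coincide, say at x and x + kp. As G y is the mex of the
-- used values together with 𝒴_y, and 𝒴 is p-periodic, equal windows at y and y + kp force
-- G (y + kp) = G y + kp and equal windows at y + 1 and y + 1 + kp, so kp is an additive
-- period of G. Given one period, every smaller candidate is tested on a single block, so the
-- least period exists and is at most kp ≤ C(M, |M⁻|) p.
module Submission where

open import Data.Bool using (Bool; true; false; if_then_else_)
open import Data.Empty using (⊥-elim)
open import Data.Fin using (zero; suc; toℕ; fromℕ<)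
open import Data.Fin.Properties using (pigeonhole; toℕ-fromℕ<; toℕ<n)
open import Data.Integer as ℤ using (ℤ; -[1+_]; 0ℤ; 1ℤ; +<+; ∣_∣)
import Data.Integer.Properties as ℤP
open import Data.Integer.Tactic.RingSolver using (solve-∀)
open import Data.List using (List; map; length; lookup)
open import Data.List.Membership.Propositional using (_∈_)
open import Data.List.Membership.Propositional.Properties using (∈-map⁺; ∈-map⁻; ∈-lookup)
import Data.List.Relation.Unary.All as All
open import Data.List.Relation.Unary.AllPairs using (_∷_)
open import Data.List.Relation.Unary.Unique.Propositional using (Unique)
open import Data.Nat
open import Data.Nat.Combinatorics using (_C_; nCk+nC[k+1]≡[n+1]C[k+1]; nCk≡nC[n∸k])
open import Data.Nat.DivMod using (_/_; _%_; m≡m%n+[m/n]*n; m%n<n)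
open import Data.Nat.Properties
open import Algebra.Properties.CommutativeSemigroup +-commutativeSemigroup using (xy∙z≈xz∙y)
open import Data.Product using (Σ; ∃; ∃₂; _×_; _,_; proj₁; proj₂)
open import Data.Sum using (_⊎_; inj₁; inj₂; [_,_])
open import Data.Sum.Function.Propositional using (_⊎-⇔_)
open import Function using (_∘_; const)
open import Function.Bundles using (_⇔_; mk⇔; Equivalence)
open import Function.Construct.Composition using (_⇔-∘_)
open import Function.Construct.Symmetry using (⇔-sym)
open import Relation.Nullary using (¬_; Dec; yes; no; does; contradiction; ¬?)
open import Relation.Nullary.Decidable using (decidable-stable; dec-true; dec-false; does-⇔; _×-dec_; _→-dec_)
open import Relation.Binary.PropositionalEquality hiding ([_])

open import Defs

open Equivalence using (to; from)

all<-suc : ∀ {P : ℕ → Set} {n} → P n → (∀ {v} → v < n → P v) → ∀ {v} → v < suc n → P v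
all<-suc Pn all v<1+n with m<1+n⇒m<n∨m≡n v<1+n
... | inj₁ v<n = all v<n
... | inj₂ refl = Pn

≤-induction : ∀ {P : ℕ → Set} {x} → P x → (∀ {y} → x ≤ y → P y → P (suc y)) →
              ∀ {y} → x ≤ y → P y
≤-induction {P} {x} Px step = go ∘ ≤⇒≤′
  where
  go : ∀ {y} → x ≤′ y → P y
  go ≤′-refl = Px
  go (≤′-step x≤′y) = step (≤′⇒≤ x≤′y) (go x≤′y)

module _ {P : ℕ → Set} (P? : ∀ n → Dec (P n)) where

  all-or-counterexample : ∀ n → (∀ {k} → k < n → P k) ⊎ ∃ λ k → k < n × ¬ P k
  all-or-counterexample n with anyUpTo? (¬? ∘ P?) n
  ... | yes (k , k<n , ¬Pk) = inj₂ (k , k<n , ¬Pk)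
  ... | no ∄ = inj₁ λ {k} k<n → decidable-stable (P? k) (λ ¬Pk → ∄ (k , k<n , ¬Pk))

  least-witness : ∀ n → (∃ λ m → m < n × P m) →
                  ∃ λ m → m < n × P m × (∀ {k} → k < m → ¬ P k)
  least-witness (suc n) w@(m , m<1+n , Pm) with anyUpTo? P? n
  ... | yes w′ = let m′ , m′<n , Pm′ , minimal = least-witness n w′
                 in m′ , m<n⇒m<1+n m′<n , Pm′ , minimal
  ... | no ∄ with m<1+n⇒m<n∨m≡n m<1+n
  ...   | inj₁ m<n = contradiction (m , m<n , Pm) ∄
  ...   | inj₂ refl = m , m<1+n , Pm , λ k<m Pk → ∄ (_ , k<m , Pk)

pigeonhole-ℕ : ∀ {m} (f : ℕ → ℕ) → (∀ t → f t < m) → ∃₂ λ i j → i < j × j ≤ m × f i ≡ f j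
pigeonhole-ℕ {m} f f<m with pigeonhole (n<1+n m) (λ t → fromℕ< (f<m (toℕ t)))
... | i , j , i<j , eq = toℕ i , toℕ j , i<j , s≤s⁻¹ (toℕ<n j) ,
                         trans (sym (toℕ-fromℕ< _)) (trans (cong toℕ eq) (toℕ-fromℕ< _))

lookup-injective : ∀ {A : Set} {xs : List A} → Unique xs → ∀ {i j} → lookup xs i ≡ lookup xs j → i ≡ j
lookup-injective (_ ∷ _) {zero} {zero} _ = refl
lookup-injective (x∉ ∷ _) {zero} {suc j} eq = contradiction eq (All.lookup x∉ (∈-lookup j))
lookup-injective (x∉ ∷ _) {suc i} {zero} eq = contradiction (sym eq) (All.lookup x∉ (∈-lookup i))
lookup-injective (_ ∷ unique) {suc i} {suc j} eq = cong suc (lookup-injective unique eq)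

count : (ℕ → Bool) → ℕ → ℕ
count f zero = 0
count f (suc n) = if f n then suc (count f n) else count f n

count-≤ : ∀ f n → count f n ≤ n
count-≤ f zero = z≤n
count-≤ f (suc n) with f n
... | true = s≤s (count-≤ f n)
... | false = m≤n⇒m≤1+n (count-≤ f n)

count-false : ∀ n → count (const false) n ≡ 0
count-false zero = refl
count-false (suc n) = count-false n

count≡n⇒all : ∀ f n → count f n ≡ n → ∀ {v} → v < n → f v ≡ true
count≡n⇒all f (suc n) eq with f n in fn
... | true = all<-suc fn (count≡n⇒all f n (suc-injective eq))
... | false = contradiction (subst (_≤ n) eq (count-≤ f n)) 1+n≰n

all⇒count≡n : ∀ f n → (∀ {v} → v < n → f v ≡ true) → count f n ≡ n
all⇒count≡n f zero _ = refl
all⇒count≡n f (suc n) all rewrite all (n<1+n n) = cong suc (all⇒count≡n f n (all ∘ m<n⇒m<1+n))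

count-cong : ∀ {f g} n → (∀ {v} → v < n → f v ≡ g v) → count f n ≡ count g n
count-cong zero _ = refl
count-cong {f} {g} (suc n) eq rewrite eq (n<1+n n) =
  cong (λ c → if g n then suc c else c) (count-cong n (eq ∘ m<n⇒m<1+n))

count-+ : ∀ f m n → count f (m + n) ≡ count f m + count (λ i → f (m + i)) n
count-+ f m zero = trans (cong (count f) (+-identityʳ m)) (sym (+-identityʳ _))
count-+ f m (suc n) rewrite +-suc m n with f (m + n)
... | true = trans (cong suc (count-+ f m n)) (sym (+-suc _ _))
... | false = count-+ f m n

count-insert : ∀ {f g e} n → e < n → f e ≡ false → g e ≡ true → (∀ {v} → v ≢ e → g v ≡ f v) →
               count g n ≡ suc (count f n)
count-insert {f} {g} {e} (suc n) e<1+n fe ge elsewhere with m<1+n⇒m<n∨m≡n e<1+n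
... | inj₂ refl rewrite fe | ge = cong suc (count-cong n (elsewhere ∘ <⇒≢))
... | inj₁ e<n rewrite elsewhere (>⇒≢ e<n) with f n
...   | true = cong suc (count-insert n e<n fe ge elsewhere)
...   | false = count-insert n e<n fe ge elsewhere

-- The combinatorial number system: if f is true exactly at c₁ < … < c_k below n, then
-- rank f n = Σᵢ cᵢ C i, a bijection onto the numbers below n C k.
rank : (ℕ → Bool) → ℕ → ℕ
rank f zero = 0
rank f (suc n) = if f n then n C suc (count f n) + rank f n else rank f n

nCk≤[n+1]Ck : ∀ n k → n C k ≤ suc n C k
nCk≤[n+1]Ck n zero = ≤-refl
nCk≤[n+1]Ck n (suc k) = subst (n C suc k ≤_) (nCk+nC[k+1]≡[n+1]C[k+1] n k) (m≤n+m _ _)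

rank<C : ∀ f n → rank f n < n C count f n
rank<C f zero = s≤s z≤n
rank<C f (suc n) with f n
... | false = <-≤-trans (rank<C f n) (nCk≤[n+1]Ck n (count f n))
... | true = begin-strict
  n C suc k + rank f n  <⟨ +-monoʳ-< (n C suc k) (rank<C f n) ⟩
  n C suc k + n C k     ≡⟨ +-comm (n C suc k) (n C k) ⟩
  n C k + n C suc k     ≡⟨ nCk+nC[k+1]≡[n+1]C[k+1] n k ⟩
  suc n C suc k         ∎
  where
  open ≤-Reasoning
  k = count f n

rank-last : ∀ f g n → suc (count f n) ≡ count g n → n C suc (count f n) + rank f n ≢ rank g n
rank-last f g n counts ranks = <⇒≱ (rank<C g n) (begin
  n C count g n              ≡⟨ cong (n C_) counts ⟨
  n C suc (count f n)        ≤⟨ m≤m+n _ _ ⟩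
  n C suc (count f n) + rank f n ≡⟨ ranks ⟩
  rank g n                   ∎)
  where open ≤-Reasoning

rank-injective : ∀ f g n → count f n ≡ count g n → rank f n ≡ rank g n → ∀ {v} → v < n → f v ≡ g v
rank-injective f g (suc n) counts ranks with f n in fn | g n in gn
... | true | true = all<-suc (trans fn (sym gn)) (rank-injective f g n counts′ (+-cancelˡ-≡ _ _ _ ranks′))
  where
  counts′ = suc-injective counts
  ranks′ : n C suc (count f n) + rank f n ≡ n C suc (count f n) + rank g n
  ranks′ = trans ranks (cong (λ k → n C suc k + rank g n) (sym counts′))
... | false | false = all<-suc (trans fn (sym gn)) (rank-injective f g n counts ranks)
... | true | false = contradiction ranks (rank-last f g n counts)
... | false | true = contradiction (sym ranks) (rank-last g f n (sym counts))

mex-≤ : ∀ {S : ℕ → Set} {m v} → IsMex S m → ¬ S v → m ≤ v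
mex-≤ (_ , below) ¬Sv = ≮⇒≥ (¬Sv ∘ below _)

mex-≥ : ∀ {S : ℕ → Set} {m c} → IsMex S m → (∀ {v} → v < c → S v) → c ≤ m
mex-≥ (¬Sm , _) below = ≮⇒≥ (¬Sm ∘ below)

mex-shift : ∀ {A A′ : ℕ → Set} {c d m m′} →
            (∀ {v} → v < c → A v) → (∀ {v} → v < c + d → A′ v) →
            (∀ {v} → c ≤ v → A v ⇔ A′ (v + d)) →
            IsMex A m → IsMex A′ m′ → m′ ≡ m + d
mex-shift {A′ = A′} {c} {d} {m} {m′} lowA lowA′ shift mexA mexA′ = ≤-antisym m′≤m+d m+d≤m′
  where
  c≤m = mex-≥ mexA lowA
  c+d≤m′ = mex-≥ mexA′ lowA′
  m′∸d+d≡m′ : m′ ∸ d + d ≡ m′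
  m′∸d+d≡m′ = m∸n+n≡m (≤-trans (m≤n+m d c) c+d≤m′)
  m′≤m+d : m′ ≤ m + d
  m′≤m+d = mex-≤ mexA′ (proj₁ mexA ∘ from (shift c≤m))
  m+d≤m′ : m + d ≤ m′
  m+d≤m′ = subst (m + d ≤_) m′∸d+d≡m′ (+-monoˡ-≤ d (mex-≤ mexA
    (proj₁ mexA′ ∘ subst A′ m′∸d+d≡m′ ∘ to (shift (m+n≤o⇒m≤o∸n c c+d≤m′)))))

shift-iterate : ∀ {R : ℕ → ℕ → Set} {p} → (∀ {x k} → R x k ⇔ R (x + p) (k + p)) →
                ∀ n {x k} → R x k ⇔ R (x + n * p) (k + n * p)
shift-iterate {R} _ zero {x} {k} =
  mk⇔ (subst₂ R (sym (+-identityʳ x)) (sym (+-identityʳ k))) (subst₂ R (+-identityʳ x) (+-identityʳ k))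
shift-iterate {R} {p} shift (suc n) {x} {k} =
  subst₂ (λ x′ k′ → R (x + n * p) (k + n * p) ⇔ R x′ k′) (reassoc x) (reassoc k)
         (shift {x + n * p} {k + n * p})
  ⇔-∘ shift-iterate {R} {p} shift n
  where
  reassoc : ∀ z → z + n * p + p ≡ z + (p + n * p)
  reassoc z = trans (+-assoc z (n * p) p) (cong (z +_) (+-comm (n * p) p))

module LeastAddPeriod (G : ℕ → ℕ) {d} .{{_ : NonZero d}} (P : ℕ)
                      (period : ∀ y → P ≤ y → G (y + d) ≡ G y + d) where

  period-iterate : ∀ n {y} → P ≤ y → G (y + n * d) ≡ G y + n * d
  period-iterate zero {y} _ = trans (cong G (+-identityʳ y)) (sym (+-identityʳ (G y)))
  period-iterate (suc n) {y} P≤y = begin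
    G (y + (d + n * d))  ≡⟨ cong G (reassoc y) ⟩
    G (y + n * d + d)    ≡⟨ period (y + n * d) (≤-trans P≤y (m≤m+n y _)) ⟩
    G (y + n * d) + d    ≡⟨ cong (_+ d) (period-iterate n P≤y) ⟩
    G y + n * d + d      ≡⟨ reassoc (G y) ⟨
    G y + (d + n * d)    ∎
    where
    open ≡-Reasoning
    reassoc : ∀ z → z + (d + n * d) ≡ z + n * d + d
    reassoc z = trans (cong (z +_) (+-comm d (n * d))) (sym (+-assoc z (n * d) d))

  translate-by-period : ∀ n q {z} → P ≤ z → G (z + n * d + q) ≡ G (z + n * d) + q ⇔ G (z + q) ≡ G z + q
  translate-by-period n q {z} P≤z = mk⇔
    (λ h → +-cancelʳ-≡ (n * d) _ _ (trans (sym lhs) (trans h rhs)))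
    (λ h → trans lhs (trans (cong (_+ n * d) h) (sym rhs)))
    where
    lhs : G (z + n * d + q) ≡ G (z + q) + n * d
    lhs = trans (cong G (xy∙z≈xz∙y z (n * d) q)) (period-iterate n (≤-trans P≤z (m≤m+n z q)))
    rhs : G (z + n * d) + q ≡ G z + q + n * d
    rhs = trans (cong (_+ q) (period-iterate n P≤z)) (xy∙z≈xz∙y (G z) (n * d) q)

  -- Because d is a period from P on, whether q is one is decided on the block [P, P + d).
  PeriodicOnBlock : ℕ → Set
  PeriodicOnBlock q = ∀ {i} → i < d → G (P + i + q) ≡ G (P + i) + q

  block⇒period : ∀ q → PeriodicOnBlock q → HasAddPeriod G q
  block⇒period q block = P , λ y P≤y →
    subst (λ z → G (z + q) ≡ G z + q) (P+r%d+[r/d]*d≡y P≤y)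
          (from (translate-by-period ((y ∸ P) / d) q (m≤m+n P _)) (block (m%n<n (y ∸ P) d)))
    where
    P+r%d+[r/d]*d≡y : ∀ {y} → P ≤ y → P + (y ∸ P) % d + (y ∸ P) / d * d ≡ y
    P+r%d+[r/d]*d≡y {y} P≤y =
      trans (+-assoc P _ _) (trans (cong (P +_) (sym (m≡m%n+[m/n]*n (y ∸ P) d))) (m+[n∸m]≡n P≤y))

  period⇒block : ∀ q → HasAddPeriod G q → PeriodicOnBlock q
  period⇒block q (P′ , period′) {i} _ =
    to (translate-by-period P′ q (m≤m+n P i)) (period′ _ (≤-trans (m≤m*n P′ d) (m≤n+m _ (P + i))))

  least-addPeriod : Σ ℕ λ q → IsAddPeriodLength G q × q ≤ d
  least-addPeriod with least-witness (λ q → (0 <? q) ×-dec block? q) (suc d)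
                                     (d , ≤-refl , >-nonZero⁻¹ d , period⇒block d (P , period))
    where
    block? : ∀ q → Dec (PeriodicOnBlock q)
    block? q = allUpTo? (λ i → G (P + i + q) ≟ G (P + i) + q) d
  ... | q , q<1+d , (0<q , block) , minimal =
    q , (0<q , block⇒period q block , λ q′ 0<q′ period′ →
          ≮⇒≥ (λ q′<q → minimal q′<q (0<q′ , period⇒block q′ period′))) , s≤s⁻¹ q<1+d

-- Y x k stands for k ∈ 𝒴_x; negative elements of 𝒴_x never matter for a mex.
-- Y-lower and Y-upper say 𝒴_x ∩ ℕ ⊆ (x − a, x + b) with a = |M⁻|, b = M⁺; L is the seed length.
module NimSequence (Y : ℕ → ℕ → Set) (a b : ℕ)
                   (Y-lower : ∀ {x k} → Y x k → x < k + a)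
                   (Y-upper : ∀ {x k} → Y x k → k < x + b)
                   (L : ℕ) (G : ℕ → ℕ)
                   (seed-fresh : ∀ {x′ x} → x′ < x → x < L → G x′ ≢ G x)
                   (G-mex : ∀ x → L ≤ x →
                            IsMex (λ k → (∃ λ x′ → x′ < x × G x′ ≡ k) ⊎ Y x k) (G x))
                   where

  Used : ℕ → ℕ → Set
  Used x v = ∃ λ x′ → x′ < x × G x′ ≡ v

  used? : ∀ x v → Dec (Used x v)
  used? x v = anyUpTo? (λ x′ → G x′ ≟ v) x

  used : ℕ → ℕ → Bool
  used x v = does (used? x v)

  used⇒Used : ∀ {x v} → used x v ≡ true → Used x v
  used⇒Used {x} {v} eq with used? x v
  ... | yes u = u
  ... | no _ = contradiction eq λ ()

  used≡⇒⇔ : ∀ {x v y w} → used x v ≡ used y w → Used x v ⇔ Used y w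
  used≡⇒⇔ {x} {v} {y} {w} eq = mk⇔
    (λ u → used⇒Used (trans (sym eq) (dec-true (used? x v) u)))
    (λ u → used⇒Used (trans eq (dec-true (used? y w) u)))

  Used-mono : ∀ {x y v} → x ≤ y → Used x v → Used y v
  Used-mono x≤y (x′ , x′<x , eq) = x′ , <-≤-trans x′<x x≤y , eq

  Used-suc : ∀ {x v} → Used (suc x) v ⇔ (Used x v ⊎ G x ≡ v)
  Used-suc {x} = mk⇔ split [ Used-mono (n≤1+n x) , (λ eq → x , ≤-refl , eq) ]
    where
    split : ∀ {v} → Used (suc x) v → Used x v ⊎ G x ≡ v
    split (x′ , x′<1+x , eq) with m<1+n⇒m<n∨m≡n x′<1+x
    ... | inj₁ x′<x = inj₁ (x′ , x′<x , eq)
    ... | inj₂ refl = inj₂ eq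

  used-suc : ∀ {x v} → v ≢ G x → used (suc x) v ≡ used x v
  used-suc {x} {v} v≢Gx =
    does-⇔ (mk⇔ (shrink ∘ to Used-suc) (Used-mono (n≤1+n x))) (used? (suc x) v) (used? x v)
    where
    shrink : Used x v ⊎ G x ≡ v → Used x v
    shrink (inj₁ u) = u
    shrink (inj₂ eq) = contradiction (sym eq) v≢Gx

  G-fresh : ∀ x → ¬ Used x (G x)
  G-fresh x (x′ , x′<x , eq) with L ≤? x
  ... | yes L≤x = proj₁ (G-mex x L≤x) (inj₁ (x′ , x′<x , eq))
  ... | no L≰x = seed-fresh x′<x (≰⇒> L≰x) eq

  ¬Y-low : ∀ {x v} → v + a ≤ x → ¬ Y x v
  ¬Y-low le y = <⇒≱ (Y-lower y) le

  ¬Y-high : ∀ {x v} → x + b ≤ v → ¬ Y x v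
  ¬Y-high le y = <⇒≱ (Y-upper y) le

  G-≤ : ∀ {x v} → L ≤ x → ¬ Used x v → ¬ Y x v → G x ≤ v
  G-≤ {x} L≤x ¬used ¬y = mex-≤ (G-mex x L≤x) [ ¬used , ¬y ]

  count-used-suc : ∀ {x n} → G x < n → count (used (suc x)) n ≡ suc (count (used x) n)
  count-used-suc {x} G<n = count-insert _ G<n (dec-false (used? x (G x)) (G-fresh x))
                             (dec-true (used? (suc x) (G x)) (x , ≤-refl , refl)) (used-suc {x})

  count-used-suc-≥ : ∀ {x n} → n ≤ G x → count (used (suc x)) n ≡ count (used x) n
  count-used-suc-≥ n≤G = count-cong _ (λ v<n → used-suc (<⇒≢ (<-≤-trans v<n n≤G)))

  count-used-≤ : ∀ x n → count (used x) n ≤ x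
  count-used-≤ zero n = ≤-reflexive (count-false n)
  count-used-≤ (suc x) n with G x <? n
  ... | yes G<n = ≤-trans (≤-reflexive (count-used-suc G<n)) (s≤s (count-used-≤ x n))
  ... | no G≮n =
    ≤-trans (≤-reflexive (count-used-suc-≥ (≮⇒≥ G≮n))) (m≤n⇒m≤1+n (count-used-≤ x n))

  ValuesBelow : ℕ → ℕ → Set
  ValuesBelow x n = ∀ {x′} → x′ < x → G x′ < n

  valuesBelow-exists : ∀ x → ∃ (ValuesBelow x)
  valuesBelow-exists zero = 0 , λ ()
  valuesBelow-exists (suc x) with valuesBelow-exists x
  ... | n , below =
    n ⊔ suc (G x) , all<-suc (m≤n⊔m n _) (λ x′<x → <-≤-trans (below x′<x) (m≤m⊔n n _))

  count-used : ∀ x {n} → ValuesBelow x n → count (used x) n ≡ x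
  count-used zero {n} _ = count-false n
  count-used (suc x) below =
    trans (count-used-suc (below (n<1+n x))) (cong suc (count-used x (below ∘ m<n⇒m<1+n)))

  count-used-frozen : ∀ k {x n} → (∀ {j} → j < k → n ≤ G (j + x)) →
                      count (used (k + x)) n ≡ count (used x) n
  count-used-frozen zero _ = refl
  count-used-frozen (suc k) big =
    trans (count-used-suc-≥ (big (n<1+n k))) (count-used-frozen k (big ∘ m<n⇒m<1+n))

  Saturated : ℕ → Set
  Saturated x = ∀ {v} → v + a < x → Used x v

  saturated-suc : ∀ {x} → L ≤ x → Saturated x → Saturated (suc x)
  saturated-suc {x} L≤x sat {v} v+a<1+x with m<1+n⇒m<n∨m≡n v+a<1+x
  ... | inj₁ v+a<x = Used-mono (n≤1+n x) (sat v+a<x)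
  ... | inj₂ v+a≡x with used? x v
  ...   | yes u = Used-mono (n≤1+n x) u
  ...   | no ¬u = x , ≤-refl , ≤-antisym (G-≤ L≤x ¬u (¬Y-low (≤-reflexive v+a≡x))) v≤G
    where
    v≤G : v ≤ G x
    v≤G = ≮⇒≥ λ G<v → G-fresh x (sat (subst (G x + a <_) v+a≡x (+-monoˡ-< a G<v)))

  saturated-from : ∀ {x} → L ≤ x → Saturated x → ∀ {y} → x ≤ y → Saturated y
  saturated-from L≤x sat = ≤-induction {Saturated} sat (λ x≤y → saturated-suc (≤-trans L≤x x≤y))

  saturated? : ∀ x → Saturated x ⊎ ∃ λ v → v + a < x × ¬ Used x v
  saturated? x with all-or-counterexample (λ v → (v + a <? x) →-dec used? x v) x
  ... | inj₁ all = inj₁ λ {v} v+a<x → all (≤-<-trans (m≤m+n v a) v+a<x) v+a<x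
  ... | inj₂ (v , _ , ¬claim) with v + a <? x
  ...   | yes v+a<x = inj₂ (v , v+a<x , ¬claim ∘ const)
  ...   | no v+a≮x = ⊥-elim (¬claim (λ v+a<x → contradiction v+a<x v+a≮x))

  saturated⇒count-used : ∀ {y n} → Saturated y → n + a ≤ y → count (used y) n ≡ n
  saturated⇒count-used {y} {n} sat n+a≤y =
    all⇒count≡n (used y) n (λ {v} v<n → dec-true (used? y v) (sat (<-≤-trans (+-monoˡ-< a v<n) n+a≤y)))

  -- Every unsaturated step takes a value below k + x; after k of them the k + x values used
  -- so far are exactly 0, …, k + x − 1, which is saturation.
  saturated-within : ∀ k {x} → L ≤ x → ValuesBelow x (k + x) → ∃ λ y → x ≤ y × Saturated y
  saturated-within zero {x} _ below = x , ≤-refl , λ {v} v+a<x →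
    used⇒Used (count≡n⇒all (used x) x (count-used x below) (≤-<-trans (m≤m+n v a) v+a<x))
  saturated-within (suc k) {x} L≤x below with saturated? x
  ... | inj₁ sat = x , ≤-refl , sat
  ... | inj₂ (v , v+a<x , ¬u) =
    let y , 1+x≤y , sat = saturated-within k (m≤n⇒m≤1+n L≤x) below′
    in y , ≤-trans (n≤1+n x) 1+x≤y , sat
    where
    G<x : G x < x
    G<x = ≤-<-trans (G-≤ L≤x ¬u (¬Y-low (<⇒≤ v+a<x))) (≤-<-trans (m≤m+n v a) v+a<x)
    below′ : ValuesBelow (suc x) (k + suc x)
    below′ rewrite +-suc k x = all<-suc (<-≤-trans G<x (m≤n+m x (suc k))) below

  Bounded : ℕ → ℕ → Set
  Bounded x c = ValuesBelow x (x + c)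

  bounded-suc : ∀ {x c} → L ≤ x → b ≤ c → Bounded x c → Bounded (suc x) c
  bounded-suc {x} {c} L≤x b≤c bounded =
    all<-suc (s≤s (G-≤ L≤x (λ (_ , x′<x , eq) → <-irrefl eq (bounded x′<x))
                           (¬Y-high (+-monoʳ-≤ x b≤c))))
             (m<n⇒m<1+n ∘ bounded)

  bounded-from : ∀ {x c} → L ≤ x → b ≤ c → Bounded x c → ∀ {y} → x ≤ y → Bounded y c
  bounded-from {c = c} L≤x b≤c bounded =
    ≤-induction {λ y → Bounded y c} bounded (λ x≤y → bounded-suc (≤-trans L≤x x≤y) b≤c)

  -- If G took values ≥ x + 1 + c during the next 1 + c + a steps, the values below x + 1 + c
  -- used by then would already be used at x, but saturation says all of them are used.
  bound-decreases : ∀ {x c} → L ≤ x → b ≤ c → Saturated x → Bounded x (suc c) →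
                    ∃ λ y → x ≤ y × Bounded y c
  bound-decreases {x} {c} L≤x b≤c sat bounded
    with all-or-counterexample (λ j → x + suc c ≤? G (j + x)) (suc c + a)
  ... | inj₁ big = contradiction (begin-strict
        x                                 <⟨ m<m+n x z<s ⟩
        x + suc c                         ≡⟨ saturated⇒count-used sat′ fits ⟨
        count (used (R + x)) (x + suc c)  ≡⟨ count-used-frozen R big ⟩
        count (used x) (x + suc c)        ≤⟨ count-used-≤ x (x + suc c) ⟩
        x                                 ∎) (<-irrefl refl)
    where
    open ≤-Reasoning
    R = suc c + a
    sat′ = saturated-from L≤x sat (m≤n+m x R)
    fits : x + suc c + a ≤ R + x
    fits = ≤-reflexive (trans (+-assoc x (suc c) a) (+-comm x R))
  ... | inj₂ (j , _ , G≱) = suc (j + x) , ≤-trans (m≤n+m x j) (n≤1+n _) ,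
        all<-suc {λ x′ → G x′ < suc (j + x) + c} (<-≤-trans (≰⇒> G≱) grow)
                 (λ {x′} x′<j+x → subst (G x′ <_) (+-suc (j + x) c)
                   (bounded-from L≤x (m≤n⇒m≤1+n b≤c) bounded (m≤n+m x j) x′<j+x))
    where
    grow : x + suc c ≤ suc (j + x + c)
    grow = subst (_≤ suc (j + x + c)) (sym (+-suc x c)) (s≤s (+-monoˡ-≤ c (m≤n+m x j)))

  tighten : ∀ t {x} → L ≤ x → Saturated x → Bounded x (b + t) →
            ∃ λ y → x ≤ y × Saturated y × Bounded y b
  tighten zero {x} _ sat bounded = x , ≤-refl , sat , subst (Bounded x) (+-identityʳ b) bounded
  tighten (suc t) L≤x sat bounded =
    let y , x≤y , bounded′ = bound-decreases L≤x (m≤m+n b t) sat (subst (Bounded _) (+-suc b t) bounded)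
        z , y≤z , sat′ , bounded″ = tighten t (≤-trans L≤x x≤y) (saturated-from L≤x sat x≤y) bounded′
    in z , ≤-trans x≤y y≤z , sat′ , bounded″

  Settled : ℕ → Set
  Settled y = L ≤ y × a ≤ y × Saturated y × Bounded y b

  SettledFrom : ℕ → Set
  SettledFrom T = ∀ {y} → T ≤ y → Settled y

  eventually-settled : ∃ SettledFrom
  eventually-settled =
    let B , below = valuesBelow-exists L
        bounded : Bounded L (b + B)
        bounded = λ x′<L → <-≤-trans (below x′<L)
                                     (≤-trans (m≤n+m B (L + b)) (≤-reflexive (+-assoc L b B)))
        x , L≤x , sat = saturated-within B ≤-refl (λ x′<L → <-≤-trans (below x′<L) (m≤m+n B L))
        y , x≤y , sat′ , bounded′ = tighten B L≤x sat (bounded-from ≤-refl (m≤m+n b B) bounded L≤x)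
        L≤y = ≤-trans L≤x x≤y
    in y + a , λ y+a≤z → let y≤z = ≤-trans (m≤m+n y a) y+a≤z in
       ≤-trans L≤y y≤z , ≤-trans (m≤n+m a y) y+a≤z ,
       saturated-from L≤y sat′ y≤z , bounded-from L≤y ≤-refl bounded′ y≤z

  window : ℕ → ℕ → Bool
  window y i = used y (y ∸ a + i)

  -- Before y exactly y values are used: all y − a values below y − a and none from y + b on.
  count-window : ∀ {y} → Settled y → count (window y) (a + b) ≡ a
  count-window {y} (_ , a≤y , sat , bounded) = +-cancelˡ-≡ (y ∸ a) _ _ (begin
    y ∸ a + w                         ≡⟨ cong (_+ w) (saturated⇒count-used sat (≤-reflexive y∸a+a≡y)) ⟨
    count (used y) (y ∸ a) + w        ≡⟨ count-+ (used y) (y ∸ a) (a + b) ⟨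
    count (used y) (y ∸ a + (a + b))  ≡⟨ cong (count (used y)) y∸a+[a+b]≡y+b ⟩
    count (used y) (y + b)            ≡⟨ count-used y bounded ⟩
    y                                 ≡⟨ y∸a+a≡y ⟨
    y ∸ a + a                         ∎)
    where
    open ≡-Reasoning
    w = count (window y) (a + b)
    y∸a+a≡y = m∸n+n≡m a≤y
    y∸a+[a+b]≡y+b = trans (sym (+-assoc (y ∸ a) a b)) (cong (_+ b) y∸a+a≡y)

  Agree : ℕ → ℕ → Set
  Agree x d = ∀ {v} → x ≤ v + a → Used x v ⇔ Used (x + d) (v + d)

  window-agree : ∀ {x d} → Settled x → Settled (x + d) →
                 (∀ {i} → i < a + b → window x i ≡ window (x + d) i) → Agree x d
  window-agree {x} {d} (_ , a≤x , _ , bounded) (_ , _ , _ , bounded′) same {v} x≤v+a with v <? x + b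
  ... | yes v<x+b = used≡⇒⇔ (begin
    used x v                ≡⟨ cong (used x) (m+[n∸m]≡n x∸a≤v) ⟨
    window x i              ≡⟨ same i<a+b ⟩
    window (x + d) i        ≡⟨ cong (used (x + d)) shifted ⟩
    used (x + d) (v + d)    ∎)
    where
    open ≡-Reasoning
    x∸a≤v = m≤n+o⇒m∸n≤o x a (subst (x ≤_) (+-comm v a) x≤v+a)
    i = v ∸ (x ∸ a)
    i<a+b : i < a + b
    i<a+b = subst (i <_) (m+n∸m≡n (x ∸ a) (a + b)) (∸-monoˡ-< (subst (v <_) x+b≡x∸a+[a+b] v<x+b) x∸a≤v)
      where
      x+b≡x∸a+[a+b] = trans (cong (_+ b) (sym (m∸n+n≡m a≤x))) (+-assoc (x ∸ a) a b)
    shifted : x + d ∸ a + i ≡ v + d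
    shifted = trans (cong (_+ i) (+-∸-comm d a≤x))
                    (trans (xy∙z≈xz∙y (x ∸ a) d i) (cong (_+ d) (m+[n∸m]≡n x∸a≤v)))
  ... | no v≮x+b = mk⇔ (λ (_ , x′<x , eq) → contradiction (subst (_< x + b) eq (bounded x′<x)) v≮x+b)
                       (λ (_ , x′<x+d , eq) → contradiction (+-cancelʳ-< d v (x + b)
                          (subst₂ _<_ eq (xy∙z≈xz∙y x d b) (bounded′ x′<x+d))) v≮x+b)

  module _ {d} (Y-shift : ∀ {x k} → Y x k ⇔ Y (x + d) (k + d)) where

    agree-step : ∀ {x} → Settled x → Settled (x + d) → Agree x d → G (x + d) ≡ G x + d × Agree (suc x) d
    agree-step {x} (L≤x , a≤x , sat , _) (L≤x+d , a≤x+d , sat′ , _) agree = G-shift , agree′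
      where
      x+d∸a≡x∸a+d : x + d ∸ a ≡ x ∸ a + d
      x+d∸a≡x∸a+d = +-∸-comm d a≤x
      below-window : ∀ {y v} → a ≤ y → v < y ∸ a → v + a < y
      below-window a≤y v<y∸a = subst (_ <_) (m∸n+n≡m a≤y) (+-monoˡ-< a v<y∸a)
      G-shift : G (x + d) ≡ G x + d
      G-shift = mex-shift
        (inj₁ ∘ sat ∘ below-window a≤x)
        (λ {v} v<x∸a+d → inj₁ (sat′ (below-window a≤x+d (subst (v <_) (sym x+d∸a≡x∸a+d) v<x∸a+d))))
        (λ x∸a≤v → agree (subst (_≤ _) (m∸n+n≡m a≤x) (+-monoˡ-≤ a x∸a≤v)) ⊎-⇔ Y-shift)
        (G-mex x L≤x) (G-mex (x + d) L≤x+d)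
      agree′ : Agree (suc x) d
      agree′ 1+x≤v+a =
        ⇔-sym Used-suc ⇔-∘ ((agree (≤-trans (n≤1+n x) 1+x≤v+a) ⊎-⇔ shift-G) ⇔-∘ Used-suc)
        where
        shift-G : ∀ {v} → G x ≡ v ⇔ G (x + d) ≡ v + d
        shift-G = mk⇔ (λ eq → trans G-shift (cong (_+ d) eq))
                      (λ eq → +-cancelʳ-≡ d _ _ (trans (sym G-shift) eq))

    agree⇒period : ∀ {T x} → SettledFrom T → T ≤ x → Agree x d → ∀ y → x ≤ y → G (y + d) ≡ G y + d
    agree⇒period {T} {x} settled T≤x agree y x≤y = proj₁ (step (≤-trans T≤x x≤y) (agree-from x≤y))
      where
      step : ∀ {z} → T ≤ z → Agree z d → G (z + d) ≡ G z + d × Agree (suc z) d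
      step T≤z = agree-step (settled T≤z) (settled (≤-trans T≤z (m≤m+n _ d)))
      agree-from : ∀ {y} → x ≤ y → Agree y d
      agree-from = ≤-induction {λ z → Agree z d} agree (λ x≤z → proj₂ ∘ step (≤-trans T≤x x≤z))

  module _ {p} .{{_ : NonZero p}} (Y-shift : ∀ {x k} → Y x k ⇔ Y (x + p) (k + p)) where

    module _ {T} (settled : SettledFrom T) where

      sample : ℕ → ℕ
      sample t = T + t * p

      collision⇒addPeriod : ∀ {i j} → i < j →
                            rank (window (sample i)) (a + b) ≡ rank (window (sample j)) (a + b) →
                            HasAddPeriod G ((j ∸ i) * p)
      collision⇒addPeriod {i} {j} i<j ranks =
        sample i , agree⇒period (shift-iterate {Y} {p} Y-shift k) settled (m≤m+n T (i * p)) agree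
        where
        k = j ∸ i
        yᵢ = sample i
        yⱼ = sample j
        yⱼ≡yᵢ+kp : yⱼ ≡ yᵢ + k * p
        yⱼ≡yᵢ+kp = trans (cong (λ n → T + n * p) (sym (m+[n∸m]≡n (<⇒≤ i<j))))
                    (trans (cong (T +_) (*-distribʳ-+ p i k)) (sym (+-assoc T (i * p) (k * p))))
        settledᵢ : Settled yᵢ
        settledᵢ = settled (m≤m+n T (i * p))
        settledⱼ : Settled yⱼ
        settledⱼ = settled (m≤m+n T (j * p))
        windows : ∀ {l} → l < a + b → window yᵢ l ≡ window yⱼ l
        windows = rank-injective (window yᵢ) (window yⱼ) (a + b)
                    (trans (count-window settledᵢ) (sym (count-window settledⱼ))) ranks
        agree : Agree yᵢ (k * p)
        agree = window-agree settledᵢ (subst Settled yⱼ≡yᵢ+kp settledⱼ)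
                  (λ {l} l<a+b → trans (windows l<a+b) (cong (λ z → window z l) yⱼ≡yᵢ+kp))

      rank-window<C : ∀ t → rank (window (sample t)) (a + b) < (a + b) C a
      rank-window<C t = subst (rank (window (sample t)) (a + b) <_)
                              (cong ((a + b) C_) (count-window (settled (m≤m+n T (t * p)))))
                              (rank<C (window (sample t)) (a + b))

      addPeriod : ∃ λ d → NonZero d × d ≤ ((a + b) C a) * p × HasAddPeriod G d
      addPeriod =
        let i , j , i<j , j≤C , ranks = pigeonhole-ℕ (λ t → rank (window (sample t)) (a + b)) rank-window<C
        in (j ∸ i) * p , m*n≢0 (j ∸ i) p {{>-nonZero (m<n⇒0<n∸m i<j)}} ,
           *-monoˡ-≤ p (≤-trans (m∸n≤m j i) j≤C) , collision⇒addPeriod i<j ranks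

    addPeriodLength : Σ ℕ λ p̃ → IsAddPeriodLength G p̃ × p̃ ≤ ((a + b) C a) * p
    addPeriodLength =
      let d , d≢0 , d≤ , P , period = addPeriod (proj₂ eventually-settled)
          p̃ , isLength , p̃≤d = LeastAddPeriod.least-addPeriod G {{d≢0}} P period
      in p̃ , isLength , ≤-trans p̃≤d d≤

nC[m⊓n] : ∀ m n → (m + n) C m ≡ (m + n) C (m ⊓ n)
nC[m⊓n] m n with ≤-total m n
... | inj₁ m≤n = cong ((m + n) C_) (sym (m≤n⇒m⊓n≡m m≤n))
... | inj₂ n≤m = trans (nCk≡nC[n∸k] (m≤m+n m n))
                   (cong ((m + n) C_) (trans (m+n∸m≡n m n) (sym (m≥n⇒m⊓n≡n n≤m))))

upper-diff⇒< : ∀ k x b → (ℤ.+ k ℤ.- ℤ.+ x) ℤ.+ 1ℤ ℤ.≤ ℤ.+ b → k < x + b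
upper-diff⇒< k x b le = subst (suc k ≤_) (+-comm b x)
  (ℤP.drop‿+≤+ (subst (ℤ._≤ ℤ.+ (b + x)) (rearrange (ℤ.+ k) (ℤ.+ x)) (ℤP.+-monoˡ-≤ (ℤ.+ x) le)))
  where
  rearrange : ∀ K X → ((K ℤ.- X) ℤ.+ 1ℤ) ℤ.+ X ≡ 1ℤ ℤ.+ K
  rearrange = solve-∀

lower-diff⇒< : ∀ k x a → -[1+ a ] ℤ.≤ (ℤ.+ k ℤ.- ℤ.+ x) ℤ.- 1ℤ → x < k + suc a
lower-diff⇒< k x a le = subst (x <_) (sym (+-suc k a))
  (s≤s (ℤP.drop‿+≤+ (subst₂ ℤ._≤_ (cancel (ℤ.+ x) (ℤ.+ a)) (rearrange (ℤ.+ k) (ℤ.+ x) (ℤ.+ a))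
    (ℤP.+-monoˡ-≤ (ℤ.+ x ℤ.+ ℤ.+ suc a) le))))
  where
  cancel : ∀ X A → ℤ.- (1ℤ ℤ.+ A) ℤ.+ (X ℤ.+ (1ℤ ℤ.+ A)) ≡ X
  cancel = solve-∀
  rearrange : ∀ K X A → ((K ℤ.- X) ℤ.- 1ℤ) ℤ.+ (X ℤ.+ (1ℤ ℤ.+ A)) ≡ K ℤ.+ A
  rearrange = solve-∀

shiftInvariant⇒ℕ : ∀ {Y p} → ShiftInvariant Y p →
                   ∀ {x k} → ℤ.+ k ∈ Y x ⇔ ℤ.+ (k + p) ∈ Y (x + p)
shiftInvariant⇒ℕ {Y} {p} shift {x} {k} = mk⇔
  (λ k∈ → from (shift x _)
            (subst (_∈ map (ℤ._+ ℤ.+ p) (Y x)) (sym (ℤP.pos-+ k p)) (∈-map⁺ (ℤ._+ ℤ.+ p) k∈)))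
  (λ k+p∈ → let z , z∈ , eq = ∈-map⁻ (ℤ._+ ℤ.+ p) (to (shift x _) k+p∈)
            in subst (_∈ Y x) (sym (cancel z (trans (sym (ℤP.pos-+ k p)) eq))) z∈)
  where
  cancel : ∀ z → ℤ.+ k ℤ.+ ℤ.+ p ≡ z ℤ.+ ℤ.+ p → ℤ.+ k ≡ z
  cancel z eq = trans (sym (undo (ℤ.+ k) (ℤ.+ p))) (trans (cong (ℤ._- ℤ.+ p) eq) (undo z (ℤ.+ p)))
    where
    undo : ∀ X P → (X ℤ.+ P) ℤ.- P ≡ X
    undo = solve-∀

theoremt : (Y : SetSeq) (p : ℕ) (Mp Mm : ℤ)
    → IsAddPeriodicSeqWithPeriod Y p
    → IsUpperDiffBound Y Mp → IsLowerDiffBound Y Mm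
    → Mm ℤ.< 0ℤ → 0ℤ ℤ.< Mp
    → (s : List ℕ) → Unique s → (G : ℕ → ℕ) → IsNimSeq Y s G
    → Σ ℕ λ p̃ → IsAddPeriodLength G p̃
    × p̃ ≤ ((∣ Mm ∣ + ∣ Mp ∣) C (∣ Mm ∣ ⊓ ∣ Mp ∣)) * p
theoremt _ _ _ (ℤ.+ _) _ _ _ (+<+ ()) _ _ _ _ _
theoremt _ _ -[1+ _ ] -[1+ _ ] _ _ _ _ () _ _ _ _
theoremt Y p (ℤ.+ b) -[1+ a ] (0<p , shift , _) (upper , _) (lower , _) _ _ s unique G (seed , mex) =
  let p̃ , isLength , p̃≤ = NimSequence.addPeriodLength (λ x k → ℤ.+ k ∈ Y x) (suc a) b
                            (λ {x} {k} k∈ → lower-diff⇒< k x a (lower x (ℤ.+ k) k∈))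
                            (λ {x} {k} k∈ → upper-diff⇒< k x b (upper x (ℤ.+ k) k∈))
                            (length s) G seed-fresh mex {{>-nonZero 0<p}} (shiftInvariant⇒ℕ shift)
  in p̃ , isLength , subst (λ n → p̃ ≤ n * p) (nC[m⊓n] (suc a) b) p̃≤
  where
  seed-fresh : ∀ {x′ x} → x′ < x → x < length s → G x′ ≢ G x
  seed-fresh {x′} {x} x′<x x<L eq = <⇒≢ x′<x (trans (sym (toℕ-fromℕ< _)) (trans
    (cong toℕ (lookup-injective unique (trans (sym (seed x′ (<-trans x′<x x<L))) (trans eq (seed x x<L)))))
    (toℕ-fromℕ< x<L)))
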